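{- (i) For every integer $s\ge1$, $\overline{\gamma}(\mathbb{Z},\{\pm s\})=1/3$. (ii) For every nonempty set $S\subseteq\mathbb{Z}\setminus\{0\}$, $1/(|\pm S|+1)\le\overline{\gamma}(\mathbb{Z},\pm S)\le 1/3$. (iii) If $s=5k\pm2$ for some $k\in\mathbb{Z}$, then $\overline{\gamma}(\mathbb{Z},\{\pm1,\pm s\})=1/5$.
   Context: For $S\subseteq\mathbb{Z}\setminus\{0\}$, write $\pm S=\{\pm s: s\in S\}$. The digraph $\Gamma(\mathbb{Z},T)$ for $T\subseteq\mathbb{Z}\setminus\{0\}$ has vertex set $\mathbb{Z}$ and a directed edge $(g,g+t)$ for all $g\in\mathbb{Z}$, $t\in T$. A vertex $u$ dominates $v$ if $u=v$ or $(u,v)$ is an edge; $D\subseteq\mathbb{Z}$ is a dominating set if every integer is dominated by an element of $D$. The density of $U\subseteq\mathbb{Z}$ is $\delta(U)=\liminf_{n\to\infty}|U\cap[-n,n]|/(2n+1)$, and $\overline{\gamma}(\mathbb{Z},T)$ is the infimum of $\delta(D)$ over all dominating sets $D$ of $\Gamma(\mathbb{Z},T)$. -}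

module Defs where

open import Data.Bool using (Bool; true; false)
open import Data.Nat as ℕ using (ℕ; zero; suc)
open import Data.Integer as ℤ using (ℤ; +_; -[1+_]; 0ℤ)
open import Data.Rational as ℚ using (ℚ; 0ℚ)
open import Data.Product using (Σ; ∃; _×_; _,_)
open import Data.Sum using (_⊎_)
open import Data.List using (List; length)
open import Data.List.Membership.Propositional using (_∈_)
open import Data.List.Relation.Unary.Unique.Propositional using (Unique)
open import Relation.Binary.PropositionalEquality using (_≡_; _≢_)
open import Relation.Nullary using (¬_)

Subset : Set₁
Subset = ℤ → Set

pm : Subset → Subset
pm S x = S x ⊎ S (ℤ.- x)

-- u dominates v in Γ(ℤ,T): u = v or (u,v) is an edge, i.e. v = u + t, t ∈ T.
Dominates : Subset → ℤ → ℤ → Set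
Dominates T u v = (u ≡ v) ⊎ (Σ ℤ λ t → T t × v ≡ u ℤ.+ t)

-- Candidate dominating sets are given by their characteristic function
-- (needed to count |D ∩ [-n,n]|).
IsDominating : Subset → (ℤ → Bool) → Set
IsDominating T D = ∀ v → Σ ℤ λ u → D u ≡ true × Dominates T u v

b2n : Bool → ℕ
b2n true = 1
b2n false = 0

count : (ℤ → Bool) → ℕ → ℕ
count D zero = b2n (D 0ℤ)
count D (suc n) = count D n ℕ.+ b2n (D (+ suc n)) ℕ.+ b2n (D -[1+ n ])

ratio : (ℤ → Bool) → ℕ → ℚ
ratio D n = (+ count D n) ℚ./ suc (2 ℕ.* n)

-- δ(D) ≥ c, where δ(D) = liminf ratio D n:
--   for every ε > 0, eventually ratio D n > c - ε.
DensityGE : (ℤ → Bool) → ℚ → Set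
DensityGE D c = ∀ (ε : ℚ) → 0ℚ ℚ.< ε →
  Σ ℕ λ N → ∀ n → N ℕ.≤ n → c ℚ.- ε ℚ.< ratio D n

DensityLE : (ℤ → Bool) → ℚ → Set
DensityLE D c = ∀ (ε : ℚ) → 0ℚ ℚ.< ε → ∀ (N : ℕ) →
  Σ ℕ λ n → N ℕ.≤ n × ratio D n ℚ.< c ℚ.+ ε

-- γ̄(ℤ,T) ≥ c  (c is a lower bound of all δ(D), D dominating)
γ̄≥ : Subset → ℚ → Set
γ̄≥ T c = ∀ (D : ℤ → Bool) → IsDominating T D → DensityGE D c

γ̄≤ : Subset → ℚ → Set
γ̄≤ T c = ∀ (ε : ℚ) → 0ℚ ℚ.< ε →
  Σ (ℤ → Bool) λ D → IsDominating T D × DensityLE D (c ℚ.+ ε)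

γ̄≡ : Subset → ℚ → Set
γ̄≡ T c = γ̄≥ T c × γ̄≤ T c

-- L enumerates the subset A exactly, without repetitions (so |A| = length L).
Enumerates : List ℤ → Subset → Set
Enumerates L A = Unique L × (∀ x → (x ∈ L → A x) × (A x → x ∈ L))

pmSingle : ℤ → Subset
pmSingle s x = (x ≡ s) ⊎ (x ≡ ℤ.- s)

pmOneAnd : ℤ → Subset
pmOneAnd s x = (x ≡ + 1) ⊎ (x ≡ ℤ.- (+ 1)) ⊎ (x ≡ s) ⊎ (x ≡ ℤ.- s)

{-# OPTIONS --safe #-}

-- Lower bounds are a double count. If every step of T lies in a finite list L, a
-- vertex dominates at most |L| + 1 vertices, all within distance M = Σ_{t ∈ L} |t|.
-- Hence the 2k + 1 integers of [-k, k] are dominated by elements of D ∩ [-(k+M), k+M],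
-- each dominating at most |L| + 1 of them, so 2k + 1 ≤ (|L| + 1) |D ∩ [-(k+M), k+M]|;
-- letting k → ∞ gives δ(D) ≥ 1 / (|L| + 1).
-- Upper bounds come from periodic dominating sets: {x : x mod 3a < a} when ±a are
-- steps, and 5ℤ for the steps ±1, ±(5k ± 2). The density of a periodic set is the
-- proportion of residues it contains.

module Submission where

module FiniteSums where

  open import Data.Nat
  open import Data.Nat.Properties
  open import Algebra.Properties.CommutativeSemigroup +-commutativeSemigroup using (interchange)
  open import Data.List using (List; []; _∷_; length)
  open import Data.List.Membership.Propositional using (_∈_)
  open import Data.List.Relation.Unary.Any using (here; there)
  open import Relation.Binary.PropositionalEquality
  open import Relation.Nullary using (Dec; does)
  open import Relation.Nullary.Decidable using (dec-true; dec-false)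
  open import Defs using (b2n)

  ∑< : ℕ → (ℕ → ℕ) → ℕ
  ∑< zero    f = 0
  ∑< (suc l) f = f 0 + ∑< l (λ i → f (suc i))

  ∑<-split : ∀ a b f → ∑< (a + b) f ≡ ∑< a f + ∑< b (λ i → f (a + i))
  ∑<-split zero    b f = refl
  ∑<-split (suc a) b f = trans (cong (f 0 +_) (∑<-split a b (λ i → f (suc i))))
                               (sym (+-assoc (f 0) _ _))

  ∑<-suc : ∀ l f → ∑< (suc l) f ≡ ∑< l f + f l
  ∑<-suc l f = begin
    ∑< (suc l) f                     ≡⟨ cong (λ n → ∑< n f) (+-comm 1 l) ⟩
    ∑< (l + 1) f                     ≡⟨ ∑<-split l 1 f ⟩
    ∑< l f + (f (l + 0) + 0)         ≡⟨ cong (λ x → ∑< l f + (f x + 0)) (+-identityʳ l) ⟩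
    ∑< l f + (f l + 0)               ≡⟨ cong (∑< l f +_) (+-identityʳ (f l)) ⟩
    ∑< l f + f l                     ∎
    where open ≡-Reasoning

  ∑<-cong : ∀ l {f g} → (∀ i → i < l → f i ≡ g i) → ∑< l f ≡ ∑< l g
  ∑<-cong zero    eq = refl
  ∑<-cong (suc l) eq = cong₂ _+_ (eq 0 z<s) (∑<-cong l (λ i i<l → eq (suc i) (s<s i<l)))

  ∑<-mono-≤ : ∀ l {f g} → (∀ i → i < l → f i ≤ g i) → ∑< l f ≤ ∑< l g
  ∑<-mono-≤ zero    le = z≤n
  ∑<-mono-≤ (suc l) le = +-mono-≤ (le 0 z<s) (∑<-mono-≤ l (λ i i<l → le (suc i) (s<s i<l)))

  ∑<-zero : ∀ l {f} → (∀ i → f i ≡ 0) → ∑< l f ≡ 0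
  ∑<-zero zero    eq = refl
  ∑<-zero (suc l) eq = cong₂ _+_ (eq 0) (∑<-zero l (λ i → eq (suc i)))

  ∑<-const : ∀ l c → ∑< l (λ _ → c) ≡ l * c
  ∑<-const zero    c = refl
  ∑<-const (suc l) c = cong (c +_) (∑<-const l c)

  ∑<-distrib-+ : ∀ l f g → ∑< l (λ i → f i + g i) ≡ ∑< l f + ∑< l g
  ∑<-distrib-+ zero    f g = refl
  ∑<-distrib-+ (suc l) f g =
    trans (cong (f 0 + g 0 +_) (∑<-distrib-+ l _ _)) (interchange (f 0) (g 0) _ _)

  *-distribˡ-∑< : ∀ l c f → c * ∑< l f ≡ ∑< l (λ i → c * f i)
  *-distribˡ-∑< zero    c f = *-zeroʳ c
  *-distribˡ-∑< (suc l) c f = trans (*-distribˡ-+ c (f 0) _) (cong (c * f 0 +_) (*-distribˡ-∑< l c _))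

  *-distribʳ-∑< : ∀ l c f → ∑< l f * c ≡ ∑< l (λ i → f i * c)
  *-distribʳ-∑< l c f = trans (*-comm (∑< l f) c)
    (trans (*-distribˡ-∑< l c f) (∑<-cong l (λ i _ → *-comm c (f i))))

  ∑<-comm : ∀ a b (f : ℕ → ℕ → ℕ) →
    ∑< a (λ i → ∑< b (λ j → f i j)) ≡ ∑< b (λ j → ∑< a (λ i → f i j))
  ∑<-comm zero    b f = sym (∑<-zero b (λ _ → refl))
  ∑<-comm (suc a) b f = trans (cong (∑< b (f 0) +_) (∑<-comm a b (λ i → f (suc i))))
                              (sym (∑<-distrib-+ b (f 0) _))

  term≤∑< : ∀ l f {i} → i < l → f i ≤ ∑< l f
  term≤∑< (suc l) f {zero}  _         = m≤m+n (f 0) _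
  term≤∑< (suc l) f {suc i} (s<s i<l) = ≤-trans (term≤∑< l _ i<l) (m≤n+m _ (f 0))

  ∑<-monoˡ-≤ : ∀ f {l l′} → l ≤ l′ → ∑< l f ≤ ∑< l′ f
  ∑<-monoˡ-≤ f {l} {l′} l≤l′ = begin
    ∑< l f                                ≤⟨ m≤m+n _ _ ⟩
    ∑< l f + ∑< (l′ ∸ l) (λ i → f (l + i)) ≡⟨ sym (∑<-split l (l′ ∸ l) f) ⟩
    ∑< (l + (l′ ∸ l)) f                   ≡⟨ cong (λ n → ∑< n f) (m+[n∸m]≡n l≤l′) ⟩
    ∑< l′ f                               ∎
    where open ≤-Reasoning

  ∑[_] : ∀ {A : Set} → List A → (A → ℕ) → ℕ
  ∑[ []     ] g = 0
  ∑[ x ∷ xs ] g = g x + ∑[ xs ] g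

  ∑[]-mono-≤ : ∀ {A : Set} (xs : List A) {f g} → (∀ x → f x ≤ g x) → ∑[ xs ] f ≤ ∑[ xs ] g
  ∑[]-mono-≤ []       le = z≤n
  ∑[]-mono-≤ (x ∷ xs) le = +-mono-≤ (le x) (∑[]-mono-≤ xs le)

  ∑[]-const : ∀ {A : Set} (xs : List A) c → ∑[ xs ] (λ _ → c) ≡ length xs * c
  ∑[]-const []       c = refl
  ∑[]-const (x ∷ xs) c = cong (c +_) (∑[]-const xs c)

  ∈⇒≤∑[] : ∀ {A : Set} {xs : List A} g {x} → x ∈ xs → g x ≤ ∑[ xs ] g
  ∈⇒≤∑[] g (here refl) = m≤m+n _ _
  ∈⇒≤∑[] g (there x∈xs) = ≤-trans (∈⇒≤∑[] g x∈xs) (m≤n+m _ _)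

  ∑<-∑[]-comm : ∀ {A : Set} l (xs : List A) (f : ℕ → A → ℕ) →
    ∑< l (λ i → ∑[ xs ] (f i)) ≡ ∑[ xs ] (λ x → ∑< l (λ i → f i x))
  ∑<-∑[]-comm l []       f = ∑<-zero l (λ _ → refl)
  ∑<-∑[]-comm l (x ∷ xs) f = trans (∑<-distrib-+ l (λ i → f i x) (λ i → ∑[ xs ] (f i)))
                                  (cong (∑< l (λ i → f i x) +_) (∑<-∑[]-comm l xs f))

  𝟙 : ∀ {A : Set} → Dec A → ℕ
  𝟙 a? = b2n (does a?)

  ∑<-𝟙[<] : ∀ a b → ∑< (a + b) (λ i → 𝟙 (i <? a)) ≡ a
  ∑<-𝟙[<] a b = begin
    ∑< (a + b) (λ i → 𝟙 (i <? a))                          ≡⟨ ∑<-split a b _ ⟩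
    ∑< a (λ i → 𝟙 (i <? a)) + ∑< b (λ i → 𝟙 (a + i <? a))
      ≡⟨ cong₂ _+_ (∑<-cong a (λ i i<a → cong b2n (dec-true (i <? a) i<a)))
                   (∑<-zero b (λ i → cong b2n (dec-false (a + i <? a) (m+n≮m a i)))) ⟩
    ∑< a (λ _ → 1) + 0                                      ≡⟨ +-identityʳ _ ⟩
    ∑< a (λ _ → 1)                                          ≡⟨ ∑<-const a 1 ⟩
    a * 1                                                   ≡⟨ *-identityʳ a ⟩
    a                                                       ∎
    where open ≡-Reasoning

module Windows where

  open FiniteSums
  open import Defs
  open import Data.Nat as ℕ using (ℕ; zero; suc; _≤_; _<_; s≤s; z≤n)
  import Data.Nat.Properties as ℕP
  open import Data.Nat.Tactic.RingSolver using (solve-∀)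
  open import Data.Integer as ℤ using (ℤ; +_; -[1+_]; _⊖_; ∣_∣)
  import Data.Integer.Properties as ℤP
  open import Data.Product using (Σ; _×_; _,_)
  open import Relation.Binary.PropositionalEquality
  open import Relation.Nullary using (yes; no)
  open import Function using (_∘_)

  [m+n]⊖n≡m : ∀ m n → (m ℕ.+ n) ⊖ n ≡ + m
  [m+n]⊖n≡m m n = trans (ℤP.≤-⊖ (ℕP.m≤n+m n m)) (cong +_ (ℕP.m+n∸n≡m m n))

  ⊖-+-cancel : ∀ i k → i ⊖ k ℤ.+ + k ≡ + i
  ⊖-+-cancel i k = trans (ℤP.distribˡ-⊖-+-pos k i k) ([m+n]⊖n≡m i k)

  ⊖-injectiveˡ : ∀ k {i j} → i ⊖ k ≡ j ⊖ k → i ≡ j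
  ⊖-injectiveˡ k {i} {j} eq = ℤP.+-injective (begin
    + i             ≡⟨ sym (⊖-+-cancel i k) ⟩
    i ⊖ k ℤ.+ + k   ≡⟨ cong (ℤ._+ + k) eq ⟩
    j ⊖ k ℤ.+ + k   ≡⟨ ⊖-+-cancel j k ⟩
    + j             ∎)
    where open ≡-Reasoning

  [1+2n]⊖n≡1+n : ∀ n → suc (2 ℕ.* n) ⊖ n ≡ + suc n
  [1+2n]⊖n≡1+n n = trans (cong (_⊖ n) (1+2n≡[1+n]+n n)) ([m+n]⊖n≡m (suc n) n)
    where
    1+2n≡[1+n]+n : ∀ n → suc (2 ℕ.* n) ≡ suc n ℕ.+ n
    1+2n≡[1+n]+n = solve-∀

  count≡∑< : ∀ D n → count D n ≡ ∑< (suc (2 ℕ.* n)) (λ i → b2n (D (i ⊖ n)))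
  count≡∑< D zero    = sym (ℕP.+-identityʳ _)
  count≡∑< D (suc n) = begin
    count D n ℕ.+ b2n (D (+ suc n)) ℕ.+ b2n (D -[1+ n ])
      ≡⟨ ℕP.+-comm _ (b2n (D -[1+ n ])) ⟩
    b2n (D -[1+ n ]) ℕ.+ (count D n ℕ.+ b2n (D (+ suc n)))
      ≡⟨ cong (b2n (D -[1+ n ]) ℕ.+_) (cong₂ ℕ._+_ (count≡∑< D n)
                                        (cong (b2n ∘ D) (sym ([1+2n]⊖n≡1+n n)))) ⟩
    b2n (D -[1+ n ]) ℕ.+ (∑< (suc (2 ℕ.* n)) f ℕ.+ f (suc (2 ℕ.* n)))
      ≡⟨ cong (b2n (D -[1+ n ]) ℕ.+_) (sym (∑<-suc (suc (2 ℕ.* n)) f)) ⟩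
    b2n (D -[1+ n ]) ℕ.+ ∑< (suc (suc (2 ℕ.* n))) f
      ≡⟨ cong (b2n (D -[1+ n ]) ℕ.+_)
              (∑<-cong (suc (suc (2 ℕ.* n))) (λ i _ → cong (b2n ∘ D) (sym (ℤP.[1+m]⊖[1+n]≡m⊖n i n)))) ⟩
    ∑< (suc (suc (suc (2 ℕ.* n)))) (λ i → b2n (D (i ⊖ suc n)))
      ≡⟨ cong (λ l → ∑< (suc l) (λ i → b2n (D (i ⊖ suc n)))) (sym (ℕP.*-suc 2 n)) ⟩
    ∑< (suc (2 ℕ.* suc n)) (λ i → b2n (D (i ⊖ suc n)))
      ∎
    where
    open ≡-Reasoning
    f : ℕ → ℕ
    f i = b2n (D (i ⊖ n))

  ∣i⊖k∣≤k : ∀ k {i} → i < suc (2 ℕ.* k) → ∣ i ⊖ k ∣ ≤ k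
  ∣i⊖k∣≤k k {i} (s≤s i≤2k) with k ℕ.≤? i
  ... | yes k≤i = subst (_≤ k) (cong ∣_∣ (sym (ℤP.⊖-≥ k≤i)))
                        (ℕP.m≤n+o⇒m∸n≤o i k (subst (i ≤_) (cong (k ℕ.+_) (ℕP.+-identityʳ k)) i≤2k))
  ... | no  k≰i = subst (_≤ k) (trans (sym (ℤP.∣-i∣≡∣i∣ (+ (k ℕ.∸ i)))) (cong ∣_∣ (sym (ℤP.⊖-< (ℕP.≰⇒> k≰i)))))
                        (ℕP.m∸n≤m k i)

  window-index : ∀ {n} x → ∣ x ∣ ≤ n → Σ ℕ λ j → j < suc (2 ℕ.* n) × j ⊖ n ≡ x
  window-index {n} (+ a) a≤n =
    a ℕ.+ n , s≤s (ℕP.+-mono-≤ a≤n (ℕP.m≤m+n n 0)) , [m+n]⊖n≡m a n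
  window-index {n} -[1+ a ] 1+a≤n =
    n ℕ.∸ suc a , s≤s (ℕP.≤-trans (ℕP.m∸n≤m n (suc a)) (ℕP.m≤m+n n _)) ,
    trans (ℤP.⊖-< (ℕP.∸-monoʳ-< {o = 0} (s≤s z≤n) 1+a≤n)) (cong (ℤ.-_ ∘ +_) (ℕP.m∸[m∸n]≡n 1+a≤n))

module Density where

  open import Defs
  open import Data.Nat as ℕ using (ℕ; zero; suc; _≤_; _<_; s≤s; NonZero)
  import Data.Nat.Properties as ℕP
  open import Data.Nat.Tactic.RingSolver using (solve-∀)
  open import Data.Integer as ℤ using (+_; -[1+_])
  import Data.Integer.Properties as ℤP
  open import Data.Rational as ℚ using (ℚ; mkℚ; 0ℚ; _/_)
  import Data.Rational.Properties as ℚP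
  open import Data.Rational.Unnormalised as ℚᵘ using (mkℚᵘ; *<*)
  import Data.Rational.Unnormalised.Properties as ℚᵘP
  open import Data.Product using (Σ; _,_)
  open import Relation.Binary.PropositionalEquality

  positive⇒fraction : ∀ {ε} → 0ℚ ℚ.< ε → Σ ℕ λ e → Σ ℕ λ f → ε ≡ + suc e / suc f
  positive⇒fraction {mkℚ (+ suc e) f _} _ = e , f , sym (ℚP.↥p/↧p≡p _)
  positive⇒fraction {mkℚ (+ zero) f _} (ℚ.*<* (ℤ.+<+ ()))
  positive⇒fraction {mkℚ -[1+ e ] f _} (ℚ.*<* ())

  fraction<fraction+fraction : ∀ a b c d g f →
    a ℕ.* (suc d ℕ.* suc f) < (c ℕ.* suc f ℕ.+ g ℕ.* suc d) ℕ.* suc b →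
    + a / suc b ℚ.< + c / suc d ℚ.+ + g / suc f
  fraction<fraction+fraction a b c d g f ineq = ℚP.toℚᵘ-cancel-<
    (ℚᵘP.<-respˡ-≃ (ℚᵘP.≃-sym (ℚP.toℚᵘ-fromℚᵘ (mkℚᵘ (+ a) b)))
    (ℚᵘP.<-respʳ-≃ (ℚᵘP.≃-sym toℚᵘ-sum) (*<* ineqℤ)))
    where
    toℚᵘ-sum : ℚ.toℚᵘ (+ c / suc d ℚ.+ + g / suc f) ℚᵘ.≃ mkℚᵘ (+ c) d ℚᵘ.+ mkℚᵘ (+ g) f
    toℚᵘ-sum = ℚᵘP.≃-trans (ℚP.toℚᵘ-homo-+ (+ c / suc d) (+ g / suc f))
                 (ℚᵘP.+-cong (ℚP.toℚᵘ-fromℚᵘ (mkℚᵘ (+ c) d)) (ℚP.toℚᵘ-fromℚᵘ (mkℚᵘ (+ g) f)))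
    ineqℤ : + a ℤ.* + (suc d ℕ.* suc f) ℤ.< (+ c ℤ.* + suc f ℤ.+ + g ℤ.* + suc d) ℤ.* + suc b
    ineqℤ = subst₂ ℤ._<_
      (ℤP.pos-* a (suc d ℕ.* suc f))
      (trans (ℤP.pos-* (c ℕ.* suc f ℕ.+ g ℕ.* suc d) (suc b))
        (cong (ℤ._* + suc b) (trans (ℤP.pos-+ (c ℕ.* suc f) _) (cong₂ ℤ._+_ (ℤP.pos-* c _) (ℤP.pos-* g _)))))
      (ℤ.+<+ ineq)

  p<q+r⇒p-r<q : ∀ {p} q r → p ℚ.< q ℚ.+ r → p ℚ.- r ℚ.< q
  p<q+r⇒p-r<q {p} q r p<q+r = subst (p ℚ.- r ℚ.<_) q+r-r≡q (ℚP.+-monoˡ-< (ℚ.- r) p<q+r)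
    where
    q+r-r≡q : q ℚ.+ r ℚ.- r ≡ q
    q+r-r≡q = trans (ℚP.+-assoc q r (ℚ.- r)) (trans (cong (q ℚ.+_) (ℚP.+-inverseʳ r)) (ℚP.+-identityʳ q))

  densityGE-of-window-bound : ∀ D M m →
    (∀ k → suc (2 ℕ.* k) ≤ count D (k ℕ.+ M) ℕ.* suc m) → DensityGE D (+ 1 / suc m)
  densityGE-of-window-bound D M m bound ε 0<ε with positive⇒fraction 0<ε
  ... | e , f , refl = M ℕ.* suc f , eventually
    where
    arith : ∀ k {n} C → k ℕ.+ M ≡ n → suc (2 ℕ.* k) ≤ C ℕ.* suc m → M ℕ.* suc f ≤ n →
      1 ℕ.* (suc (2 ℕ.* n) ℕ.* suc f) < (C ℕ.* suc f ℕ.+ suc e ℕ.* suc (2 ℕ.* n)) ℕ.* suc m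
    arith k C refl window M[1+f]≤n = begin-strict
      1 ℕ.* (W ℕ.* suc f)                  ≡⟨ expand k M f ⟩
      suc (2 ℕ.* k) ℕ.* suc f ℕ.+ 2 ℕ.* (M ℕ.* suc f)
        ≤⟨ ℕP.+-mono-≤ (ℕP.*-monoˡ-≤ (suc f) window) (ℕP.*-monoʳ-≤ 2 M[1+f]≤n) ⟩
      C ℕ.* suc m ℕ.* suc f ℕ.+ 2 ℕ.* n
        <⟨ ℕP.+-monoʳ-< (C ℕ.* suc m ℕ.* suc f)
             (ℕP.<-≤-trans (ℕP.n<1+n (2 ℕ.* n))
               (ℕP.≤-trans (ℕP.m≤n*m W (suc e)) (ℕP.m≤m*n (suc e ℕ.* W) (suc m)))) ⟩
      C ℕ.* suc m ℕ.* suc f ℕ.+ suc e ℕ.* W ℕ.* suc m ≡⟨ collect C m f (suc e) W ⟩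
      (C ℕ.* suc f ℕ.+ suc e ℕ.* W) ℕ.* suc m ∎
      where
      open ℕP.≤-Reasoning
      n = k ℕ.+ M
      W = suc (2 ℕ.* n)
      expand : ∀ k M f → 1 ℕ.* (suc (2 ℕ.* (k ℕ.+ M)) ℕ.* suc f) ≡
                         suc (2 ℕ.* k) ℕ.* suc f ℕ.+ 2 ℕ.* (M ℕ.* suc f)
      expand = solve-∀
      collect : ∀ C m f e W → C ℕ.* suc m ℕ.* suc f ℕ.+ e ℕ.* W ℕ.* suc m ≡
                              (C ℕ.* suc f ℕ.+ e ℕ.* W) ℕ.* suc m
      collect = solve-∀

    eventually : ∀ n → M ℕ.* suc f ≤ n → + 1 / suc m ℚ.- + suc e / suc f ℚ.< ratio D n
    eventually n M[1+f]≤n = p<q+r⇒p-r<q (ratio D n) (+ suc e / suc f)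
      (fraction<fraction+fraction 1 m (count D n) (2 ℕ.* n) (suc e) f
        (arith (n ℕ.∸ M) (count D n) k+M≡n
               (subst (λ x → suc (2 ℕ.* (n ℕ.∸ M)) ≤ count D x ℕ.* suc m) k+M≡n (bound (n ℕ.∸ M)))
               M[1+f]≤n))
      where
      k+M≡n : n ℕ.∸ M ℕ.+ M ≡ n
      k+M≡n = ℕP.m∸n+n≡m (ℕP.≤-trans (ℕP.m≤m*n M (suc f)) M[1+f]≤n)

  densityLE-of-periodic-bound : ∀ D P .{{_ : NonZero P}} Q r → P ≡ suc r ℕ.* Q →
    (∀ j → count D (P ℕ.* j) ≤ suc (2 ℕ.* j) ℕ.* Q) → DensityLE D (+ 1 / suc r)
  densityLE-of-periodic-bound D P Q r P≡[1+r]Q bound ε 0<ε N with positive⇒fraction 0<ε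
  ... | e , f , refl =
    n , ℕP.≤-trans (ℕP.m≤m+n N (suc f)) (ℕP.m≤n*m j P) ,
    fraction<fraction+fraction (count D n) (2 ℕ.* n) 1 r (suc e) f arith
    where
    j = N ℕ.+ suc f
    n = P ℕ.* j
    W = suc (2 ℕ.* n)
    P[1+f]<W : P ℕ.* suc f < W
    P[1+f]<W = s≤s (ℕP.≤-trans (ℕP.*-monoʳ-≤ P (ℕP.m≤n+m (suc f) N)) (ℕP.m≤m+n n _))
    arith : count D n ℕ.* (suc r ℕ.* suc f) < (1 ℕ.* suc f ℕ.+ suc e ℕ.* suc r) ℕ.* W
    arith = begin-strict
      count D n ℕ.* (suc r ℕ.* suc f)           ≤⟨ ℕP.*-monoˡ-≤ (suc r ℕ.* suc f) (bound j) ⟩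
      suc (2 ℕ.* j) ℕ.* Q ℕ.* (suc r ℕ.* suc f) ≡⟨ regroup (suc (2 ℕ.* j)) Q (suc r) (suc f) ⟩
      suc (2 ℕ.* j) ℕ.* (suc r ℕ.* Q) ℕ.* suc f ≡⟨ cong (λ x → suc (2 ℕ.* j) ℕ.* x ℕ.* suc f) (sym P≡[1+r]Q) ⟩
      suc (2 ℕ.* j) ℕ.* P ℕ.* suc f             ≡⟨ expand j P (suc f) ⟩
      2 ℕ.* n ℕ.* suc f ℕ.+ P ℕ.* suc f
        <⟨ ℕP.+-monoʳ-< (2 ℕ.* n ℕ.* suc f)
             (ℕP.<-≤-trans P[1+f]<W (ℕP.≤-trans (ℕP.m≤n*m W (suc e ℕ.* suc r)) (ℕP.m≤n+m _ (suc f)))) ⟩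
      2 ℕ.* n ℕ.* suc f ℕ.+ (suc f ℕ.+ suc e ℕ.* suc r ℕ.* W) ≡⟨ collect n (suc f) (suc e ℕ.* suc r) ⟩
      (1 ℕ.* suc f ℕ.+ suc e ℕ.* suc r) ℕ.* W ∎
      where
      open ℕP.≤-Reasoning
      regroup : ∀ a Q r f → a ℕ.* Q ℕ.* (r ℕ.* f) ≡ a ℕ.* (r ℕ.* Q) ℕ.* f
      regroup = solve-∀
      expand : ∀ j P f → suc (2 ℕ.* j) ℕ.* P ℕ.* f ≡ 2 ℕ.* (P ℕ.* j) ℕ.* f ℕ.+ P ℕ.* f
      expand = solve-∀
      collect : ∀ n f g → 2 ℕ.* n ℕ.* f ℕ.+ (f ℕ.+ g ℕ.* suc (2 ℕ.* n)) ≡ (1 ℕ.* f ℕ.+ g) ℕ.* suc (2 ℕ.* n)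
      collect = solve-∀

  densityLE-weaken : ∀ {D c} ε → 0ℚ ℚ.≤ ε → DensityLE D c → DensityLE D (c ℚ.+ ε)
  densityLE-weaken {D} {c} ε 0≤ε below ε′ 0<ε′ N with below ε′ 0<ε′ N
  ... | n , N≤n , ratio<c+ε′ = n , N≤n , ℚP.<-≤-trans ratio<c+ε′ (ℚP.+-monoˡ-≤ ε′ c≤c+ε)
    where
    c≤c+ε : c ℚ.≤ c ℚ.+ ε
    c≤c+ε = subst (ℚ._≤ c ℚ.+ ε) (ℚP.+-identityʳ c) (ℚP.+-monoʳ-≤ c 0≤ε)

module LowerBound where

  open FiniteSums
  open Windows
  open Density
  open import Defs
  open import Data.Bool using (Bool)
  open import Data.Nat as ℕ using (ℕ; zero; suc; _≤_; _<_; s≤s; z≤n)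
  import Data.Nat.Properties as ℕP
  open import Data.Integer as ℤ using (ℤ; +_; 0ℤ; _⊖_; ∣_∣)
  open import Data.Rational using (_/_)
  import Data.Integer.Properties as ℤP
  open import Data.Integer.Tactic.RingSolver using (solve-∀)
  open import Data.Product using (Σ; _×_; _,_)
  open import Data.Sum using (inj₁; inj₂)
  open import Data.List using (List; _∷_; length)
  open import Data.List.Membership.Propositional using (_∈_)
  open import Data.List.Relation.Unary.Any using (here; there)
  open import Function using (_∘_)
  open import Relation.Binary.PropositionalEquality
  open import Relation.Nullary using (yes; no)
  open import Relation.Nullary.Decidable using (dec-true; dec-false)

  ∑<-𝟙-injective≤1 : ∀ l (f : ℕ → ℤ) w → (∀ {i j} → f i ≡ f j → i ≡ j) →
    ∑< l (λ i → 𝟙 (f i ℤ.≟ w)) ≤ 1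
  ∑<-𝟙-injective≤1 zero    f w f-inj = z≤n
  ∑<-𝟙-injective≤1 (suc l) f w f-inj with f 0 ℤ.≟ w
  ... | yes f0≡w = s≤s (ℕP.≤-reflexive (∑<-zero l (λ i →
          cong b2n (dec-false (f (suc i) ℤ.≟ w) (λ f[1+i]≡w → ℕP.0≢1+n (f-inj (trans f0≡w (sym f[1+i]≡w))))))))
  ... | no  _    = ∑<-𝟙-injective≤1 l (f ∘ suc) w (ℕP.suc-injective ∘ f-inj)

  reach : List ℤ → ℕ
  reach L = ∑[ L ] ∣_∣

  module _ (T : Subset) (L : List ℤ) (T⊆L : ∀ t → T t → t ∈ L)
           (D : ℤ → Bool) (D-dom : IsDominating T D) where

    M : ℕ
    M = reach L

    steps : List ℤ
    steps = 0ℤ ∷ L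

    hits : ℤ → ℤ → ℕ
    hits u v = ∑[ steps ] (λ t → 𝟙 (v ℤ.≟ u ℤ.+ t))

    covers : ℤ → ℤ → ℕ
    covers u v = b2n (D u) ℕ.* hits u v

    bounded-step : ∀ {u v} → Dominates T u v → Σ ℤ λ t → t ∈ steps × ∣ t ∣ ≤ M × v ≡ u ℤ.+ t
    bounded-step {u} (inj₁ u≡v)          = 0ℤ , here refl , z≤n , sym (trans (ℤP.+-identityʳ u) u≡v)
    bounded-step (inj₂ (t , Tt , v≡u+t)) = t , there (T⊆L t Tt) , ∈⇒≤∑[] ∣_∣ (T⊆L t Tt) , v≡u+t

    ∑-hits≤ : ∀ k u → ∑< (suc (2 ℕ.* k)) (λ i → hits u (i ⊖ k)) ≤ suc (length L)
    ∑-hits≤ k u = begin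
      ∑< V (λ i → hits u (i ⊖ k))
        ≡⟨ ∑<-∑[]-comm V steps (λ i t → 𝟙 ((i ⊖ k) ℤ.≟ u ℤ.+ t)) ⟩
      ∑[ steps ] (λ t → ∑< V (λ i → 𝟙 ((i ⊖ k) ℤ.≟ u ℤ.+ t)))
        ≤⟨ ∑[]-mono-≤ steps (λ t → ∑<-𝟙-injective≤1 V (_⊖ k) (u ℤ.+ t) (⊖-injectiveˡ k)) ⟩
      ∑[ steps ] (λ _ → 1)
        ≡⟨ trans (∑[]-const steps 1) (ℕP.*-identityʳ _) ⟩
      suc (length L) ∎
      where open ℕP.≤-Reasoning
            V = suc (2 ℕ.* k)

    ∣u∣≤k+M : ∀ {k v} u t → ∣ v ∣ ≤ k → ∣ t ∣ ≤ M → v ≡ u ℤ.+ t → ∣ u ∣ ≤ k ℕ.+ M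
    ∣u∣≤k+M {k} {v} u t ∣v∣≤k ∣t∣≤M v≡u+t = begin
      ∣ u ∣               ≡⟨ cong ∣_∣ (trans (u≡[u+t]-t u t) (cong (ℤ._- t) (sym v≡u+t))) ⟩
      ∣ v ℤ.- t ∣         ≤⟨ ℤP.∣i-j∣≤∣i∣+∣j∣ v t ⟩
      ∣ v ∣ ℕ.+ ∣ t ∣     ≤⟨ ℕP.+-mono-≤ ∣v∣≤k ∣t∣≤M ⟩
      k ℕ.+ M             ∎
      where
      open ℕP.≤-Reasoning
      u≡[u+t]-t : ∀ u t → u ≡ u ℤ.+ t ℤ.- t
      u≡[u+t]-t = solve-∀

    dominated-in-window : ∀ k {i} → i < suc (2 ℕ.* k) →
      1 ≤ ∑< (suc (2 ℕ.* (k ℕ.+ M))) (λ j → covers (j ⊖ (k ℕ.+ M)) (i ⊖ k))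
    dominated-in-window k {i} i<V with D-dom (i ⊖ k)
    ... | u , Du≡true , u→v with bounded-step u→v
    ... | t , t∈steps , ∣t∣≤M , v≡u+t with window-index u (∣u∣≤k+M u t (∣i⊖k∣≤k k i<V) ∣t∣≤M v≡u+t)
    ... | j , j<W , j⊖K≡u = ℕP.≤-trans 1≤covers (term≤∑< _ (λ j → covers (j ⊖ (k ℕ.+ M)) (i ⊖ k)) j<W)
      where
      1≤hits : 1 ≤ hits u (i ⊖ k)
      1≤hits = subst (_≤ hits u (i ⊖ k)) (cong b2n (dec-true ((i ⊖ k) ℤ.≟ u ℤ.+ t) v≡u+t))
                     (∈⇒≤∑[] (λ t → 𝟙 ((i ⊖ k) ℤ.≟ u ℤ.+ t)) t∈steps)
      1≤covers : 1 ≤ covers (j ⊖ (k ℕ.+ M)) (i ⊖ k)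
      1≤covers = subst (λ x → 1 ≤ covers x (i ⊖ k)) (sym j⊖K≡u)
                   (subst (λ b → 1 ≤ b2n b ℕ.* hits u (i ⊖ k)) (sym Du≡true)
                     (subst (1 ≤_) (sym (ℕP.+-identityʳ _)) 1≤hits))

    window-count-bound : ∀ k → suc (2 ℕ.* k) ≤ count D (k ℕ.+ M) ℕ.* suc (length L)
    window-count-bound k = begin
      V                                                ≡⟨ sym (trans (∑<-const V 1) (ℕP.*-identityʳ V)) ⟩
      ∑< V (λ _ → 1)                                   ≤⟨ ∑<-mono-≤ V (λ i → dominated-in-window k) ⟩
      ∑< V (λ i → ∑< W (λ j → covers (j ⊖ K) (i ⊖ k))) ≡⟨ ∑<-comm V W (λ i j → covers (j ⊖ K) (i ⊖ k)) ⟩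
      ∑< W (λ j → ∑< V (λ i → b j ℕ.* h j i))          ≡⟨ ∑<-cong W (λ j _ → sym (*-distribˡ-∑< V (b j) (h j))) ⟩
      ∑< W (λ j → b j ℕ.* ∑< V (h j))                  ≤⟨ ∑<-mono-≤ W (λ j _ → ℕP.*-monoʳ-≤ (b j) (∑-hits≤ k (j ⊖ K))) ⟩
      ∑< W (λ j → b j ℕ.* suc (length L))              ≡⟨ sym (*-distribʳ-∑< W (suc (length L)) b) ⟩
      ∑< W b ℕ.* suc (length L)                        ≡⟨ cong (ℕ._* suc (length L)) (sym (count≡∑< D K)) ⟩
      count D K ℕ.* suc (length L)                     ∎
      where
      open ℕP.≤-Reasoning
      K = k ℕ.+ M
      V = suc (2 ℕ.* k)
      W = suc (2 ℕ.* K)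
      b : ℕ → ℕ
      b j = b2n (D (j ⊖ K))
      h : ℕ → ℕ → ℕ
      h j i = hits (j ⊖ K) (i ⊖ k)

  γ̄≥-of-finite-steps : ∀ T (L : List ℤ) → (∀ t → T t → t ∈ L) → γ̄≥ T (+ 1 / suc (length L))
  γ̄≥-of-finite-steps T L T⊆L D D-dom =
    densityGE-of-window-bound D (reach L) (length L) (window-count-bound T L T⊆L D D-dom)

module Periodic where

  open FiniteSums
  open Windows
  open Density
  open import Defs
  open import Data.Bool using (Bool; true)
  open import Data.Nat as ℕ using (ℕ; zero; suc; _≤_; _<_; NonZero)
  import Data.Nat.Properties as ℕP
  import Data.Nat.DivMod as ℕD
  import Data.Nat.Tactic.RingSolver as ℕSolver
  open import Data.Integer as ℤ using (ℤ; +_; 0ℤ; _⊖_; ∣_∣; _%ℕ_; _/ℕ_)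
  import Data.Integer.Properties as ℤP
  import Data.Integer.DivMod as ℤD
  open import Data.Integer.Tactic.RingSolver using (solve-∀)
  open import Data.Rational using (_/_)
  import Data.Rational.Properties as ℚP
  open import Data.Product using (Σ; _×_; _,_)
  open import Data.Sum using (inj₁; inj₂)
  open import Data.Empty using (⊥-elim)
  open import Function using (_∘_)
  open import Relation.Binary.PropositionalEquality

  remainder-unique : ∀ P {r₁ r₂} q₁ q₂ → r₁ < P → r₂ < P →
    + r₁ ℤ.+ q₁ ℤ.* + P ≡ + r₂ ℤ.+ q₂ ℤ.* + P → r₁ ≡ r₂
  remainder-unique P {r₁} {r₂} q₁ q₂ r₁<P r₂<P eq =
    ⊖-injectiveˡ r₂ (trans r₁⊖r₂≡0 (sym (ℤP.n⊖n≡0 r₂)))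
    where
    rearrange : ∀ x y a b P → x ℤ.+ a ℤ.* P ≡ y ℤ.+ b ℤ.* P → x ℤ.- y ≡ (b ℤ.- a) ℤ.* P
    rearrange x y a b P eq = begin
      x ℤ.- y                            ≡⟨ shift x y a P ⟩
      x ℤ.+ a ℤ.* P ℤ.- (y ℤ.+ a ℤ.* P) ≡⟨ cong (ℤ._- (y ℤ.+ a ℤ.* P)) eq ⟩
      y ℤ.+ b ℤ.* P ℤ.- (y ℤ.+ a ℤ.* P) ≡⟨ cancel y a b P ⟩
      (b ℤ.- a) ℤ.* P                    ∎
      where
      open ≡-Reasoning
      shift : ∀ x y a P → x ℤ.- y ≡ x ℤ.+ a ℤ.* P ℤ.- (y ℤ.+ a ℤ.* P)
      shift = solve-∀
      cancel : ∀ y a b P → y ℤ.+ b ℤ.* P ℤ.- (y ℤ.+ a ℤ.* P) ≡ (b ℤ.- a) ℤ.* P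
      cancel = solve-∀
    ∣r₁⊖r₂∣≡∣Δq∣*P : ∣ r₁ ⊖ r₂ ∣ ≡ ∣ q₂ ℤ.- q₁ ∣ ℕ.* P
    ∣r₁⊖r₂∣≡∣Δq∣*P = trans (cong ∣_∣ (trans (sym (ℤP.m-n≡m⊖n r₁ r₂)) (rearrange (+ r₁) (+ r₂) q₁ q₂ (+ P) eq)))
                            (ℤP.∣i*j∣≡∣i∣*∣j∣ (q₂ ℤ.- q₁) (+ P))
    ∣r₁⊖r₂∣<P : ∣ r₁ ⊖ r₂ ∣ < P
    ∣r₁⊖r₂∣<P = ℕP.≤-<-trans (ℤP.∣m⊝n∣≤m⊔n r₁ r₂) (ℕP.⊔-pres-<m r₁<P r₂<P)
    r₁⊖r₂≡0 : r₁ ⊖ r₂ ≡ 0ℤ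
    r₁⊖r₂≡0 with ∣ q₂ ℤ.- q₁ ∣ | ∣r₁⊖r₂∣≡∣Δq∣*P
    ... | zero  | ∣r₁⊖r₂∣≡0  = ℤP.∣i∣≡0⇒i≡0 ∣r₁⊖r₂∣≡0
    ... | suc k | ∣r₁⊖r₂∣≡[1+k]P =
      ⊥-elim (ℕP.<⇒≱ ∣r₁⊖r₂∣<P (subst (P ≤_) (sym ∣r₁⊖r₂∣≡[1+k]P) (ℕP.m≤m+n P _)))

  Dominates-translate : ∀ T {u v} w → Dominates T u v → Dominates T (u ℤ.+ w) (v ℤ.+ w)
  Dominates-translate T w (inj₁ u≡v) = inj₁ (cong (ℤ._+ w) u≡v)
  Dominates-translate T {u} {v} w (inj₂ (t , Tt , v≡u+t)) =
    inj₂ (t , Tt , trans (cong (ℤ._+ w) v≡u+t) (swap u t w))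
    where
    swap : ∀ u t w → u ℤ.+ t ℤ.+ w ≡ u ℤ.+ w ℤ.+ t
    swap = solve-∀

  module _ (P : ℕ) .{{_ : NonZero P}} where

    [r+qP]%ℕP≡r : ∀ {r} q → r < P → (+ r ℤ.+ q ℤ.* + P) %ℕ P ≡ r
    [r+qP]%ℕP≡r {r} q r<P =
      sym (remainder-unique P q (x /ℕ P) r<P (ℤD.n%ℕd<d x P) (ℤD.a≡a%ℕn+[a/ℕn]*n x P))
      where x = + r ℤ.+ q ℤ.* + P

    [x+qP]%ℕP≡x%ℕP : ∀ x q → (x ℤ.+ q ℤ.* + P) %ℕ P ≡ x %ℕ P
    [x+qP]%ℕP≡x%ℕP x q = begin
      (x ℤ.+ q ℤ.* + P) %ℕ P                                    ≡⟨ cong (λ y → (y ℤ.+ q ℤ.* + P) %ℕ P) (ℤD.a≡a%ℕn+[a/ℕn]*n x P) ⟩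
      (+ (x %ℕ P) ℤ.+ x /ℕ P ℤ.* + P ℤ.+ q ℤ.* + P) %ℕ P        ≡⟨ cong (_%ℕ P) (regroup (+ (x %ℕ P)) (x /ℕ P) q (+ P)) ⟩
      (+ (x %ℕ P) ℤ.+ (x /ℕ P ℤ.+ q) ℤ.* + P) %ℕ P             ≡⟨ [r+qP]%ℕP≡r (x /ℕ P ℤ.+ q) (ℤD.n%ℕd<d x P) ⟩
      x %ℕ P                                                     ∎
      where
      open ≡-Reasoning
      regroup : ∀ r a b P → r ℤ.+ a ℤ.* P ℤ.+ b ℤ.* P ≡ r ℤ.+ (a ℤ.+ b) ℤ.* P
      regroup = solve-∀

    ∑<-periodic : ∀ g J → ∑< (J ℕ.* P) (λ i → g (i ℕ.% P)) ≡ J ℕ.* ∑< P g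
    ∑<-periodic g zero    = refl
    ∑<-periodic g (suc J) = begin
      ∑< (P ℕ.+ J ℕ.* P) g%                                   ≡⟨ ∑<-split P (J ℕ.* P) g% ⟩
      ∑< P g% ℕ.+ ∑< (J ℕ.* P) (λ i → g% (P ℕ.+ i))
        ≡⟨ cong₂ ℕ._+_ (∑<-cong P (λ i i<P → cong g (ℕD.m<n⇒m%n≡m i<P)))
                       (∑<-cong (J ℕ.* P) (λ i _ → cong g (trans (cong (ℕ._% P) (ℕP.+-comm P i))
                                                                 (ℕD.[m+n]%n≡m%n i P)))) ⟩
      ∑< P g ℕ.+ ∑< (J ℕ.* P) g%                              ≡⟨ cong (∑< P g ℕ.+_) (∑<-periodic g J) ⟩
      ∑< P g ℕ.+ J ℕ.* ∑< P g                                 ∎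
      where
      open ≡-Reasoning
      g% : ℕ → ℕ
      g% i = g (i ℕ.% P)

    [i⊖Pj]%ℕP≡i%P : ∀ i j → (i ⊖ (P ℕ.* j)) %ℕ P ≡ i ℕ.% P
    [i⊖Pj]%ℕP≡i%P i j = trans (cong (_%ℕ P) i⊖Pj≡i-jP) ([x+qP]%ℕP≡x%ℕP (+ i) (ℤ.- + j))
      where
      i⊖Pj≡i-jP : i ⊖ (P ℕ.* j) ≡ + i ℤ.+ ℤ.- + j ℤ.* + P
      i⊖Pj≡i-jP = begin
        i ⊖ (P ℕ.* j)               ≡⟨ sym (ℤP.m-n≡m⊖n i (P ℕ.* j)) ⟩
        + i ℤ.- + (P ℕ.* j)         ≡⟨ cong (λ x → + i ℤ.- x) (ℤP.pos-* P j) ⟩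
        + i ℤ.- + P ℤ.* + j         ≡⟨ reorder (+ i) (+ P) (+ j) ⟩
        + i ℤ.+ ℤ.- + j ℤ.* + P     ∎
        where
        open ≡-Reasoning
        reorder : ∀ x P j → x ℤ.- P ℤ.* j ≡ x ℤ.+ ℤ.- j ℤ.* P
        reorder = solve-∀

    count-periodic≤ : ∀ (F : ℕ → Bool) j →
      count (λ x → F (x %ℕ P)) (P ℕ.* j) ≤ suc (2 ℕ.* j) ℕ.* ∑< P (b2n ∘ F)
    count-periodic≤ F j = begin
      count D n                                      ≡⟨ count≡∑< D n ⟩
      ∑< (suc (2 ℕ.* n)) (λ i → b2n (D (i ⊖ n)))      ≤⟨ ∑<-monoˡ-≤ (λ i → b2n (D (i ⊖ n))) window≤periods ⟩
      ∑< (suc (2 ℕ.* j) ℕ.* P) (λ i → b2n (D (i ⊖ n)))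
        ≡⟨ ∑<-cong (suc (2 ℕ.* j) ℕ.* P) (λ i _ → cong (b2n ∘ F) ([i⊖Pj]%ℕP≡i%P i j)) ⟩
      ∑< (suc (2 ℕ.* j) ℕ.* P) (λ i → b2n (F (i ℕ.% P))) ≡⟨ ∑<-periodic (b2n ∘ F) (suc (2 ℕ.* j)) ⟩
      suc (2 ℕ.* j) ℕ.* ∑< P (b2n ∘ F)                 ∎
      where
      open ℕP.≤-Reasoning
      D : ℤ → Bool
      D x = F (x %ℕ P)
      n = P ℕ.* j
      window≤periods : suc (2 ℕ.* n) ≤ suc (2 ℕ.* j) ℕ.* P
      window≤periods = subst (suc (2 ℕ.* n) ≤_) (periods P j)
                             (ℕP.+-monoˡ-≤ (2 ℕ.* n) (ℕ.>-nonZero⁻¹ P))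
        where
        periods : ∀ P j → P ℕ.+ 2 ℕ.* (P ℕ.* j) ≡ suc (2 ℕ.* j) ℕ.* P
        periods = ℕSolver.solve-∀

    ResidueDominated : Subset → (ℕ → Bool) → ℕ → Set
    ResidueDominated T F r =
      Σ ℕ λ r′ → r′ < P × F r′ ≡ true × Σ ℤ λ q → Dominates T (+ r′ ℤ.+ q ℤ.* + P) (+ r)

    periodic-dominating : ∀ T F → (∀ r → r < P → ResidueDominated T F r) →
      IsDominating T (λ x → F (x %ℕ P))
    periodic-dominating T F covered v with covered (v %ℕ P) (ℤD.n%ℕd<d v P)
    ... | r′ , r′<P , Fr′≡true , q , r′+qP→r =
      u , trans (cong F ([r+qP]%ℕP≡r (q ℤ.+ v /ℕ P) r′<P)) Fr′≡true ,
      subst₂ (Dominates T) (regroup (+ r′) q (v /ℕ P) (+ P)) (sym (ℤD.a≡a%ℕn+[a/ℕn]*n v P))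
             (Dominates-translate T (v /ℕ P ℤ.* + P) r′+qP→r)
      where
      u = + r′ ℤ.+ (q ℤ.+ v /ℕ P) ℤ.* + P
      regroup : ∀ r a b P → r ℤ.+ a ℤ.* P ℤ.+ b ℤ.* P ≡ r ℤ.+ (a ℤ.+ b) ℤ.* P
      regroup = solve-∀

    γ̄≤-periodic : ∀ T r (F : ℕ → Bool) → P ≡ suc r ℕ.* ∑< P (b2n ∘ F) →
      IsDominating T (λ x → F (x %ℕ P)) → γ̄≤ T (+ 1 / suc r)
    γ̄≤-periodic T r F P≡[1+r]Q D-dom ε 0<ε =
      (λ x → F (x %ℕ P)) , D-dom ,
      densityLE-weaken {c = + 1 / suc r} ε (ℚP.<⇒≤ 0<ε)
        (densityLE-of-periodic-bound _ P _ r P≡[1+r]Q (count-periodic≤ F))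

module DominatingSets where

  open FiniteSums
  open Periodic
  open import Defs
  open import Data.Bool using (Bool)
  open import Data.Nat as ℕ using (ℕ; suc; _<_; s≤s; z<s; NonZero)
  import Data.Nat.Properties as ℕP
  open import Data.Integer as ℤ using (ℤ; +_; 0ℤ)
  import Data.Integer.Properties as ℤP
  open import Data.Integer.Tactic.RingSolver using (solve-∀)
  open import Data.Rational using (_/_)
  open import Data.Product using (Σ; _×_; _,_)
  open import Data.Sum using (_⊎_; inj₁; inj₂)
  open import Relation.Binary.PropositionalEquality
  open import Relation.Nullary using (does; yes; no)
  open import Relation.Nullary.Decidable using (dec-true)

  <-+-split : ∀ a {b r} → r < a ℕ.+ b → r < a ⊎ Σ ℕ λ r′ → r′ < b × r ≡ a ℕ.+ r′
  <-+-split a {b} {r} r<a+b with r ℕ.<? a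
  ... | yes r<a = inj₁ r<a
  ... | no  r≮a = inj₂ (r ℕ.∸ a , ℕP.+-cancelˡ-< a _ _ (subst (ℕ._< a ℕ.+ b) (sym a+[r∸a]≡r) r<a+b) , sym a+[r∸a]≡r)
    where a+[r∸a]≡r = ℕP.m+[n∸m]≡n (ℕP.≮⇒≥ r≮a)

  module _ (T : Subset) (a : ℕ) .{{_ : NonZero a}} (T[a] : T (+ a)) (T[-a] : T (ℤ.- + a)) where

    instance
      3a-nonZero : NonZero (3 ℕ.* a)
      3a-nonZero = ℕP.m*n≢0 3 a

    -- Residues in [a, 2a) are reached by the step a, those in [2a, 3a) by the step -a
    -- from the next period.
    lower-third : ℕ → Bool
    lower-third i = does (i ℕ.<? a)

    private
      i<a⇒i<3a : ∀ {i} → i < a → i < 3 ℕ.* a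
      i<a⇒i<3a i<a = ℕP.<-≤-trans i<a (ℕP.m≤m+n a _)

      +[a+r]≡r+0*3a+a : ∀ r → + (a ℕ.+ r) ≡ + r ℤ.+ 0ℤ ℤ.* + (3 ℕ.* a) ℤ.+ + a
      +[a+r]≡r+0*3a+a r = trans (ℤP.pos-+ a r) (reorder (+ a) (+ r) (+ (3 ℕ.* a)))
        where
        reorder : ∀ a r P → a ℤ.+ r ≡ r ℤ.+ 0ℤ ℤ.* P ℤ.+ a
        reorder = solve-∀

      +[a+[a+r]]≡r+3a-a : ∀ r → + (a ℕ.+ (a ℕ.+ r)) ≡ + r ℤ.+ + 1 ℤ.* + (3 ℕ.* a) ℤ.- + a
      +[a+[a+r]]≡r+3a-a r = begin
        + (a ℕ.+ (a ℕ.+ r))                    ≡⟨ trans (ℤP.pos-+ a _) (cong (ℤ._+_ (+ a)) (ℤP.pos-+ a r)) ⟩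
        + a ℤ.+ (+ a ℤ.+ + r)                  ≡⟨ reorder (+ a) (+ r) ⟩
        + r ℤ.+ + 1 ℤ.* (+ 3 ℤ.* + a) ℤ.- + a  ≡⟨ cong (λ P → + r ℤ.+ + 1 ℤ.* P ℤ.- + a) (sym (ℤP.pos-* 3 a)) ⟩
        + r ℤ.+ + 1 ℤ.* + (3 ℕ.* a) ℤ.- + a    ∎
        where
        open ≡-Reasoning
        reorder : ∀ a r → a ℤ.+ (a ℤ.+ r) ≡ r ℤ.+ + 1 ℤ.* (+ 3 ℤ.* a) ℤ.- a
        reorder = solve-∀

    lower-third-dominates : ∀ r → r < 3 ℕ.* a → ResidueDominated (3 ℕ.* a) T lower-third r
    lower-third-dominates r r<3a with <-+-split a r<3a
    ... | inj₁ r<a = r , i<a⇒i<3a r<a , dec-true (r ℕ.<? a) r<a , 0ℤ , inj₁ (ℤP.+-identityʳ (+ r))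
    ... | inj₂ (r′ , r′<2a , refl) with <-+-split a r′<2a
    ...   | inj₁ r′<a = r′ , i<a⇒i<3a r′<a , dec-true (r′ ℕ.<? a) r′<a , 0ℤ ,
                        inj₂ (+ a , T[a] , +[a+r]≡r+0*3a+a r′)
    ...   | inj₂ (r″ , r″<a+0 , refl) = r″ , i<a⇒i<3a r″<a , dec-true (r″ ℕ.<? a) r″<a , + 1 ,
                        inj₂ (ℤ.- + a , T[-a] , +[a+[a+r]]≡r+3a-a r″)
      where
      r″<a : r″ < a
      r″<a = subst (r″ <_) (ℕP.+-identityʳ a) r″<a+0

    γ̄≤⅓-of-symmetric-step : γ̄≤ T (+ 1 / 3)
    γ̄≤⅓-of-symmetric-step =
      γ̄≤-periodic (3 ℕ.* a) T 2 lower-third (cong (3 ℕ.*_) (sym (∑<-𝟙[<] a _)))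
        (periodic-dominating (3 ℕ.* a) T lower-third lower-third-dominates)

  -- The steps ±1 reach the residues 1 and 4; as s ≡ ±2 (mod 5), the steps ±s reach 2 and 3.
  multiple-of-5 : ℕ → Bool
  multiple-of-5 i = does (i ℕ.<? 1)

  multiples-of-5-dominate : ∀ s k → s ≡ + 5 ℤ.* k ℤ.+ + 2 ⊎ s ≡ + 5 ℤ.* k ℤ.- + 2 →
    ∀ r → r < 5 → ResidueDominated 5 (pmOneAnd s) multiple-of-5 r
  multiples-of-5-dominate s k _ 0 _ = 0 , z<s , refl , 0ℤ , inj₁ refl
  multiples-of-5-dominate s k _ 1 _ = 0 , z<s , refl , 0ℤ , inj₂ (+ 1 , inj₁ refl , refl)
  multiples-of-5-dominate s k _ 4 _ = 0 , z<s , refl , + 1 , inj₂ (ℤ.- + 1 , inj₂ (inj₁ refl) , refl)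
  multiples-of-5-dominate _ k (inj₁ refl) 2 _ =
    0 , z<s , refl , ℤ.- k , inj₂ (_ , inj₂ (inj₂ (inj₁ refl)) , two k)
    where
    two : ∀ k → + 2 ≡ + 0 ℤ.+ ℤ.- k ℤ.* + 5 ℤ.+ (+ 5 ℤ.* k ℤ.+ + 2)
    two = solve-∀
  multiples-of-5-dominate _ k (inj₂ refl) 2 _ =
    0 , z<s , refl , k , inj₂ (_ , inj₂ (inj₂ (inj₂ refl)) , two k)
    where
    two : ∀ k → + 2 ≡ + 0 ℤ.+ k ℤ.* + 5 ℤ.+ ℤ.- (+ 5 ℤ.* k ℤ.- + 2)
    two = solve-∀
  multiples-of-5-dominate _ k (inj₁ refl) 3 _ =
    0 , z<s , refl , k ℤ.+ + 1 , inj₂ (_ , inj₂ (inj₂ (inj₂ refl)) , three k)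
    where
    three : ∀ k → + 3 ≡ + 0 ℤ.+ (k ℤ.+ + 1) ℤ.* + 5 ℤ.+ ℤ.- (+ 5 ℤ.* k ℤ.+ + 2)
    three = solve-∀
  multiples-of-5-dominate _ k (inj₂ refl) 3 _ =
    0 , z<s , refl , + 1 ℤ.- k , inj₂ (_ , inj₂ (inj₂ (inj₁ refl)) , three k)
    where
    three : ∀ k → + 3 ≡ + 0 ℤ.+ (+ 1 ℤ.- k) ℤ.* + 5 ℤ.+ (+ 5 ℤ.* k ℤ.- + 2)
    three = solve-∀
  multiples-of-5-dominate s k _ (suc (suc (suc (suc (suc r))))) (s≤s (s≤s (s≤s (s≤s (s≤s ())))))

  γ̄≤⅕-pmOneAnd : ∀ s k → s ≡ + 5 ℤ.* k ℤ.+ + 2 ⊎ s ≡ + 5 ℤ.* k ℤ.- + 2 → γ̄≤ (pmOneAnd s) (+ 1 / 5)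
  γ̄≤⅕-pmOneAnd s k s≡5k±2 =
    γ̄≤-periodic 5 (pmOneAnd s) 4 multiple-of-5 refl
      (periodic-dominating 5 (pmOneAnd s) multiple-of-5 (multiples-of-5-dominate s k s≡5k±2))

open import Defs
open import Data.Nat using (suc)
open import Data.Integer using (ℤ; +_; _+_; _*_; _-_; _≤_; 0ℤ)
open import Data.Rational using (_/_)
open import Data.Product using (Σ; _×_)
open import Data.Sum using (_⊎_)
open import Data.List using (List; length)
open import Relation.Binary.PropositionalEquality using (_≡_)
open import Relation.Nullary using (¬_)

open import Data.Integer using (-_; -[1+_]; +≤+)
open import Data.Empty using (⊥-elim)
open import Data.Product using (_,_; proj₂)
open import Data.Sum using (inj₁; inj₂)
open import Data.List using (_∷_; [])
open import Data.List.Membership.Propositional using (_∈_)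
open import Data.List.Relation.Unary.Any using (here; there)
open import Relation.Binary.PropositionalEquality using (refl)
open LowerBound using (γ̄≥-of-finite-steps)
open DominatingSets using (γ̄≤⅓-of-symmetric-step; γ̄≤⅕-pmOneAnd)

pmSingle⊆ : ∀ s x → pmSingle s x → x ∈ s ∷ - s ∷ []
pmSingle⊆ s x (inj₁ refl) = here refl
pmSingle⊆ s x (inj₂ refl) = there (here refl)

pmOneAnd⊆ : ∀ s x → pmOneAnd s x → x ∈ + 1 ∷ - + 1 ∷ s ∷ - s ∷ []
pmOneAnd⊆ s x (inj₁ refl)               = here refl
pmOneAnd⊆ s x (inj₂ (inj₁ refl))        = there (here refl)
pmOneAnd⊆ s x (inj₂ (inj₂ (inj₁ refl))) = there (there (here refl))
pmOneAnd⊆ s x (inj₂ (inj₂ (inj₂ refl))) = there (there (there (here refl)))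

proposition3p7 :
    (∀ (s : ℤ) → + 1 ≤ s → γ̄≡ (pmSingle s) (+ 1 / 3))
    × (∀ (S : Subset) → Σ ℤ S → ¬ S 0ℤ →
         γ̄≤ (pm S) (+ 1 / 3)
         × (∀ (L : List ℤ) → Enumerates L (pm S) → γ̄≥ (pm S) (+ 1 / suc (length L))))
    × (∀ (s k : ℤ) → (s ≡ + 5 * k + + 2 ⊎ s ≡ + 5 * k - + 2) → γ̄≡ (pmOneAnd s) (+ 1 / 5))
proposition3p7 = part-i , part-ii , part-iii
  where
  part-i : ∀ s → + 1 ≤ s → γ̄≡ (pmSingle s) (+ 1 / 3)
  part-i (+ suc n) _ = γ̄≥-of-finite-steps (pmSingle (+ suc n)) _ (pmSingle⊆ (+ suc n)) ,
                       γ̄≤⅓-of-symmetric-step (pmSingle (+ suc n)) (suc n) (inj₁ refl) (inj₂ refl)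
  part-i (+ 0) (+≤+ ())

  part-ii : ∀ S → Σ ℤ S → ¬ S 0ℤ →
    γ̄≤ (pm S) (+ 1 / 3) × (∀ L → Enumerates L (pm S) → γ̄≥ (pm S) (+ 1 / suc (length L)))
  part-ii S (s , S[s]) ¬S[0] =
    upper s S[s] , λ L (_ , members) → γ̄≥-of-finite-steps (pm S) L (λ x → proj₂ (members x))
    where
    upper : ∀ s → S s → γ̄≤ (pm S) (+ 1 / 3)
    upper (+ 0)      S[0] = ⊥-elim (¬S[0] S[0])
    upper (+ suc n)  S[s] = γ̄≤⅓-of-symmetric-step (pm S) (suc n) (inj₁ S[s]) (inj₂ S[s])
    upper -[1+ n ]   S[s] = γ̄≤⅓-of-symmetric-step (pm S) (suc n) (inj₂ S[s]) (inj₁ S[s])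

  part-iii : ∀ s k → s ≡ + 5 * k + + 2 ⊎ s ≡ + 5 * k - + 2 → γ̄≡ (pmOneAnd s) (+ 1 / 5)
  part-iii s k s≡5k±2 = γ̄≥-of-finite-steps (pmOneAnd s) _ (pmOneAnd⊆ s) , γ̄≤⅕-pmOneAnd s k s≡5k±2
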